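{- Let $F=(V,E)$ be a connected digraph which is either a digraph-function or the inverse of a digraph-function, and let $x,y,z \in \{0, 1, +, -\}$, where $F$ is assumed simple unless $x,y\in\{0,+\}$. Then the following are equivalent: (a1) $F^{xyz}$ and $F^{yxz}$ are not isomorphic; (a2) $z \in \{+,-\}$, $x \ne y$, and $F$ is not regular.
   Context: A digraph is $F=(V,E)$ with $V$ finite nonempty and $E\subseteq V\times V$ (loops allowed, no multiple arcs); it is simple if it has no loops. For $e=(u,v)$, $t(e)=u$, $h(e)=v$. $F$ is connected if its underlying undirected graph is connected; $F$ is a digraph-function if there is $f:V\to V$ with $(x,y)\in E$ iff $y=f(x)$; the inverse is $(V,\{(y,x):(x,y)\in E\})$. $F$ is regular if all in-degrees and out-degrees equal a common value. The line digraph $F^l$ has vertex set $E$ and arcs $(p,q)$ with $h(p)=t(q)$. For a digraph $G$ on vertex set $U$: $G^0$ has no arcs, $G^1$ has all arcs $(u,v)$ with $u\ne v$, $G^+=G$, and (for simple $G$) $G^-$ is the complement (all $(u,v)$, $u\neq v$, not arcs of $G$). $F^{xyz}$ is the digraph on $V\cup E$ whose arcs are those of $F^x$ (on $V$), those of $(F^l)^y$ (on $E$), and a set $W$ between $V$ and $E$: $W=\emptyset$ if $z=0$; $W=\{(v,e):v=t(e)\}\cup\{(e,v):v=h(e)\}$ if $z=+$; $W=\{(v,e):v\neq t(e)\}\cup\{(e,v):v\neq h(e)\}$ if $z=-$; all $(v,e)$, $(e,v)$ if $z=1$ ($v\in V$, $e\in E$). Isomorphism means a vertex bijection mapping arcs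 exactly onto arcs. -}

module Defs where

open import Data.Nat using (ℕ; zero; suc; _+_)
open import Data.Fin using (Fin)
open import Data.Bool using (Bool; true; false; T; if_then_else_)
open import Data.Product using (Σ; ∃; _×_; _,_; proj₁; proj₂)
open import Data.Sum using (_⊎_; inj₁; inj₂)
open import Data.Empty using (⊥)
open import Data.Unit using (⊤)
open import Data.List using (List; map; allFin)
open import Data.Nat.ListAction using (sum)
open import Relation.Nullary using (¬_)
open import Relation.Binary.PropositionalEquality using (_≡_; _≢_)
open import Function.Bundles using (_↔_; _⇔_; Inverse)

-- A (finite, nonempty-ness imposed separately) digraph on vertex set Fin n:
-- the arc set E ⊆ V × V is given by its (decidable) indicator function.
Digraph : ℕ → Set
Digraph n = Fin n → Fin n → Bool

Arc : ∀ {n} → Digraph n → Set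
Arc {n} F = Σ (Fin n × Fin n) (λ uv → T (F (proj₁ uv) (proj₂ uv)))

tail : ∀ {n} {F : Digraph n} → Arc F → Fin n
tail ((u , v) , _) = u

head : ∀ {n} {F : Digraph n} → Arc F → Fin n
head ((u , v) , _) = v

Simple : ∀ {n} → Digraph n → Set
Simple {n} F = (v : Fin n) → F v v ≡ false

data Walk {n} (F : Digraph n) : Fin n → Fin n → Set where
  stop : ∀ {u} → Walk F u u
  fwd  : ∀ {u v w} → T (F u v) → Walk F v w → Walk F u w
  bwd  : ∀ {u v w} → T (F v u) → Walk F v w → Walk F u w

Connected : ∀ {n} → Digraph n → Set
Connected {n} F = (u v : Fin n) → Walk F u v

IsDigraphFunction : ∀ {n} → Digraph n → Set
IsDigraphFunction {n} F =
  Σ (Fin n → Fin n) λ f → (x y : Fin n) → (F x y ≡ true) ⇔ (y ≡ f x)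

Inv : ∀ {n} → Digraph n → Digraph n
Inv F x y = F y x

IsInverseOfDigraphFunction : ∀ {n} → Digraph n → Set
IsInverseOfDigraphFunction F = Σ _ λ G → IsDigraphFunction G × (F ≡ Inv G)

outdeg : ∀ {n} → Digraph n → Fin n → ℕ
outdeg {n} F v = sum (map (λ u → if F v u then 1 else 0) (allFin n))

indeg : ∀ {n} → Digraph n → Fin n → ℕ
indeg {n} F v = sum (map (λ u → if F u v then 1 else 0) (allFin n))

Regular : ∀ {n} → Digraph n → Set
Regular {n} F = Σ ℕ λ k → (v : Fin n) → (indeg F v ≡ k) × (outdeg F v ≡ k)

data Lab : Set where
  L0 L1 L+ L- : Lab

applyLab : ∀ {U : Set} → Lab → (U → U → Set) → (U → U → Set)
applyLab L0 G u v = ⊥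
applyLab L1 G u v = u ≢ v
applyLab L+ G u v = G u v
applyLab L- G u v = (u ≢ v) × ¬ G u v

LineArc : ∀ {n} (F : Digraph n) → Arc F → Arc F → Set
LineArc F p q = head p ≡ tail q

Wout : ∀ {n} {F : Digraph n} → Lab → Fin n → Arc F → Set
Wout L0 v e = ⊥
Wout L+ v e = v ≡ tail e
Wout L- v e = v ≢ tail e
Wout L1 v e = ⊤

Win : ∀ {n} {F : Digraph n} → Lab → Arc F → Fin n → Set
Win L0 e v = ⊥
Win L+ e v = v ≡ head e
Win L- e v = v ≢ head e
Win L1 e v = ⊤

XYZ : ∀ {n} (F : Digraph n) → Lab → Lab → Lab →
      (Fin n ⊎ Arc F) → (Fin n ⊎ Arc F) → Set
XYZ F x y z (inj₁ a) (inj₁ b) = applyLab x (λ u v → T (F u v)) a b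
XYZ F x y z (inj₂ p) (inj₂ q) = applyLab y (LineArc F) p q
XYZ F x y z (inj₁ v) (inj₂ e) = Wout z v e
XYZ F x y z (inj₂ e) (inj₁ v) = Win z e v

Isomorphic : ∀ {A B : Set} → (A → A → Set) → (B → B → Set) → Set
Isomorphic {A} {B} R S =
  Σ (A ↔ B) λ f → (a b : A) → R a b ⇔ S (Inverse.to f a) (Inverse.to f b)

InZeroPlus : Lab → Set
InZeroPlus z = (z ≡ L0) ⊎ (z ≡ L+)

InPlusMinus : Lab → Set
InPlusMinus z = (z ≡ L+) ⊎ (z ≡ L-)

module Submission where

-- Write F as u ↦ f u.  Then u ↦ (u , f u) is a bijection V ≅ E carrying F onto
-- its line digraph F^l, so the swap F^{xyz} ≅ F^{yxz} only has to send arcs back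
-- to vertices compatibly with F^l and with W.  Sending an arc to its tail works
-- when W carries no incidence information (z ∈ {0,1}); sending it to its head
-- works when f is a bijection, which is exactly regularity (out-degrees are 1,
-- and on Fin n a surjective f is injective).  Conversely, a non-regular F has a
-- source w (a vertex without preimage), and for z = + a small isomorphism
-- invariant of the vertex w in F^{xy+} (being a source, a source with at most
-- one out-neighbour, or having every in-neighbour as out-neighbour) has no
-- counterpart in F^{yx+}.  For z = - and F simple the complement of F^{xy-} is
-- F^{x̄ȳ+} with 0̄ = 1, +̄ = -, which reduces to z = +; the only non-simple case
-- {x,y} = {0,+} is settled by a further invariant, using connectivity.
-- Finally (Inv G)^{xyz} is the reverse of G^{xyz}, reducing inverses of
-- digraph-functions to digraph-functions.

open import Data.Nat using (ℕ; zero; suc; NonZero; _+_)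
open import Data.Nat.Properties using (1+n≰n)
open import Data.Fin using (Fin; punchOut) renaming (zero to fzero; suc to fsuc)
open import Data.Fin.Properties
  using (_≟_; any?; all?; ¬∀⟶∃¬; suc-injective; punchOut-injective; injective⇒≤)
open import Data.Bool using (Bool; true; false; T; if_then_else_)
open import Data.Bool.Properties using (T-≡; T-irrelevant; ¬-not)
open import Data.List using (map; allFin)
open import Data.List.Properties using (map-tabulate)
open import Data.Nat.ListAction using (sum)
open import Data.Empty using (⊥-elim)
open import Data.Product using (∃; _×_; _,_; proj₁; proj₂; swap)
open import Data.Product.Function.NonDependent.Propositional using (_×-⇔_)
open import Data.Sum using (_⊎_; inj₁; inj₂)
open import Data.Sum.Properties using (inj₁-injective; inj₂-injective)
open import Function using (id; _∘_; flip)
open import Function.Bundles using (_⇔_; Inverse; Equivalence; mk↔ₛ′; mk⇔)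
open import Function.Properties.Equivalence using ()
  renaming (refl to ⇔-refl; sym to ⇔-sym; trans to ⇔-trans)
open import Function.Related.TypeIsomorphisms using (¬-cong-⇔)
open import Relation.Nullary using (¬_; Dec; yes; no; contradiction)
open import Relation.Nullary.Decidable using (T?; decidable-stable; _×-dec_)
open import Relation.Binary.PropositionalEquality
  using (_≡_; _≢_; refl; sym; trans; cong; cong₂; subst; subst₂; ≢-sym)
open import Defs

-- Counting the true entries of a Boolean row; count (F v) is outdeg F v and
-- count (λ u → F u v) is indeg F v, definitionally.

indicator : Bool → ℕ
indicator b = if b then 1 else 0

count : ∀ {n} → (Fin n → Bool) → ℕ
count {n} g = sum (map (λ u → indicator (g u)) (allFin n))

count-suc : ∀ {n} (g : Fin (suc n) → Bool) →
  count g ≡ indicator (g fzero) + count (g ∘ fsuc)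
count-suc g = cong (indicator (g fzero) +_) (cong sum
  (trans (map-tabulate fsuc entry) (sym (map-tabulate id (entry ∘ fsuc)))))
  where
  entry : _ → ℕ
  entry u = indicator (g u)

count-none : ∀ {n} (g : Fin n → Bool) → (∀ u → g u ≡ false) → count g ≡ 0
count-none {zero}  g none = refl
count-none {suc n} g none = trans (count-suc g)
  (cong₂ _+_ (cong indicator (none fzero)) (count-none (g ∘ fsuc) (none ∘ fsuc)))

count-unique : ∀ {n} (g : Fin n → Bool) c → g c ≡ true →
  (∀ u → g u ≡ true → u ≡ c) → count g ≡ 1
count-unique {suc n} g fzero gc unique = trans (count-suc g)
  (cong₂ _+_ (cong indicator gc) (count-none (g ∘ fsuc) λ u →
    ¬-not λ gu → contradiction (unique (fsuc u) gu) λ ()))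
count-unique {suc n} g (fsuc c) gc unique = trans (count-suc g)
  (cong₂ _+_ (cong indicator g0≡false)
    (count-unique (g ∘ fsuc) c gc λ u gu → suc-injective (unique (fsuc u) gu)))
  where
  g0≡false : g fzero ≡ false
  g0≡false = ¬-not λ g0 → contradiction (unique fzero g0) λ ()

-- Pigeonhole: an injective endomap of Fin m is surjective (otherwise it would
-- inject Fin m into the m - 1 points it hits).
injective⇒surjective : ∀ {m} (s : Fin m → Fin m) →
  (∀ {a b} → s a ≡ s b → a ≡ b) → ∀ c → ∃ λ v → s v ≡ c
injective⇒surjective {suc m} s s-injective c with any? (λ v → s v ≟ c)
... | yes hit = hit
... | no miss = ⊥-elim (1+n≰n (injective⇒≤ squeeze-injective))
  where
  avoids : ∀ v → c ≢ s v
  avoids v c≡sv = miss (v , sym c≡sv)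
  squeeze : Fin (suc m) → Fin m
  squeeze v = punchOut (avoids v)
  squeeze-injective : ∀ {a b} → squeeze a ≡ squeeze b → a ≡ b
  squeeze-injective eq = s-injective (punchOut-injective (avoids _) (avoids _) eq)

-- Hence an endomap of Fin m with a section s is injective: s is injective, so
-- surjective, so s ∘ f is the identity.
section⇒injective : ∀ {m} (f s : Fin m → Fin m) → (∀ v → f (s v) ≡ v) →
  ∀ {a b} → f a ≡ f b → a ≡ b
section⇒injective f s f∘s≗id {a} {b} fa≡fb =
  trans (sym (s∘f≗id a)) (trans (cong s fa≡fb) (s∘f≗id b))
  where
  s-injective : ∀ {u v} → s u ≡ s v → u ≡ v
  s-injective {u} {v} su≡sv = trans (sym (f∘s≗id u)) (trans (cong f su≡sv) (f∘s≗id v))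
  s∘f≗id : ∀ c → s (f c) ≡ c
  s∘f≗id c with v , sv≡c ← injective⇒surjective s s-injective c =
    trans (cong (s ∘ f) (sym sv≡c)) (trans (cong s (f∘s≗id v)) sv≡c)

missed-point : ∀ {m} (f : Fin m → Fin m) →
  ¬ (∀ v → ∃ λ u → f u ≡ v) → ∃ λ w → ∀ u → f u ≢ w
missed-point {m} f not-onto with all? (λ v → any? (λ u → f u ≟ v))
... | yes onto = ⊥-elim (not-onto onto)
... | no ¬onto with w , ¬hit ← ¬∀⟶∃¬ m _ (λ v → any? (λ u → f u ≟ v)) ¬onto =
  w , λ u fu≡w → ¬hit (u , fu≡w)

-- It is a Σ-type,
-- from which Agda cannot recover R and S, so we work with a record wrapping it.

record _≅_ {A B : Set} (R : A → A → Set) (S : B → B → Set) : Set where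
  constructor wrap
  field
    isomorphism : Isomorphic R S

  to : A → B
  to = Inverse.to (proj₁ isomorphism)
  from : B → A
  from = Inverse.from (proj₁ isomorphism)
  to-from : ∀ b → to (from b) ≡ b
  to-from = Inverse.strictlyInverseˡ (proj₁ isomorphism)
  from-to : ∀ a → from (to a) ≡ a
  from-to = Inverse.strictlyInverseʳ (proj₁ isomorphism)

  arcs : ∀ a b → R a b ⇔ S (to a) (to b)
  arcs = proj₂ isomorphism
  preserve : ∀ {a b} → R a b → S (to a) (to b)
  preserve {a} {b} = Equivalence.to (arcs a b)
  reflect : ∀ {a b} → S (to a) (to b) → R a b
  reflect {a} {b} = Equivalence.from (arcs a b)

  pullback : ∀ b c → S b c ⇔ R (from b) (from c)
  pullback b c = ⇔-sym (subst₂ (λ b′ c′ → R (from b) (from c) ⇔ S b′ c′)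
                                 (to-from b) (to-from c) (arcs (from b) (from c)))
  reflectˡ : ∀ {a c} → S c (to a) → R (from c) a
  reflectˡ {a} {c} s = subst (R (from c)) (from-to a) (Equivalence.to (pullback c (to a)) s)
  reflectʳ : ∀ {a c} → S (to a) c → R a (from c)
  reflectʳ {a} {c} s = subst (λ t → R t (from c)) (from-to a) (Equivalence.to (pullback (to a) c) s)

  to-injective : ∀ {a a′} → to a ≡ to a′ → a ≡ a′
  to-injective {a} {a′} eq = trans (sym (from-to a)) (trans (cong from eq) (from-to a′))
  from-injective : ∀ {b b′} → from b ≡ from b′ → b ≡ b′
  from-injective {b} {b′} eq = trans (sym (to-from b)) (trans (cong to eq) (to-from b′))

mkIso : ∀ {A B : Set} {R : A → A → Set} {S : B → B → Set} (φ : A → B) (ψ : B → A) →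
  (∀ b → φ (ψ b) ≡ b) → (∀ a → ψ (φ a) ≡ a) →
  (∀ a b → R a b ⇔ S (φ a) (φ b)) → R ≅ S
mkIso φ ψ φψ ψφ preserves = wrap (mk↔ₛ′ φ ψ φψ ψφ , preserves)

iso-refl : ∀ {A : Set} {R : A → A → Set} → R ≅ R
iso-refl = mkIso id id (λ _ → refl) (λ _ → refl) (λ _ _ → ⇔-refl)

iso-sym : ∀ {A B : Set} {R : A → A → Set} {S : B → B → Set} → R ≅ S → S ≅ R
iso-sym I = mkIso from to from-to to-from pullback
  where open _≅_ I

iso-trans : ∀ {A B C : Set} {R : A → A → Set} {S : B → B → Set} {U : C → C → Set} →
  R ≅ S → S ≅ U → R ≅ U
iso-trans I J = mkIso (J.to ∘ I.to) (I.from ∘ J.from)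
  (λ c → trans (cong J.to (I.to-from (J.from c))) (J.to-from c))
  (λ a → trans (cong I.from (J.from-to (I.to a))) (I.from-to a))
  (λ a b → ⇔-trans (I.arcs a b) (J.arcs (I.to a) (I.to b)))
  where
  module I = _≅_ I
  module J = _≅_ J

non-iso-sym : ∀ {A B : Set} {R : A → A → Set} {S : B → B → Set} → ¬ (S ≅ R) → ¬ (R ≅ S)
non-iso-sym ¬S≅R = ¬S≅R ∘ iso-sym

iso-conj : ∀ {A A′ B B′ : Set} {R : A → A → Set} {R′ : A′ → A′ → Set}
  {S : B → B → Set} {S′ : B′ → B′ → Set} →
  R ≅ R′ → S ≅ S′ → (R ≅ S) ⇔ (R′ ≅ S′)
iso-conj r s = mk⇔ (λ I → iso-trans (iso-sym r) (iso-trans I s))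
                   (λ J → iso-trans r (iso-trans J (iso-sym s)))

iso-reverse : ∀ {A B : Set} {R : A → A → Set} {S : B → B → Set} →
  R ≅ S → flip R ≅ flip S
iso-reverse I = wrap (proj₁ isomorphism , λ a b → arcs b a)
  where open _≅_ I

iso-cong : ∀ {A B : Set} {R R′ : A → A → Set} {S S′ : B → B → Set} →
  (∀ a b → R a b ⇔ R′ a b) → (∀ a b → S a b ⇔ S′ a b) → R ≅ S → R′ ≅ S′
iso-cong R⇔R′ S⇔S′ I = wrap (proj₁ isomorphism , λ a b →
  ⇔-trans (⇔-sym (R⇔R′ a b)) (⇔-trans (arcs a b) (S⇔S′ _ _)))
  where open _≅_ I

Complement : ∀ {A : Set} → (A → A → Set) → A → A → Set
Complement R a b = a ≢ b × ¬ R a b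

iso-complement : ∀ {A B : Set} {R : A → A → Set} {S : B → B → Set} →
  R ≅ S → Complement R ≅ Complement S
iso-complement I = wrap (proj₁ isomorphism , λ a b →
  ¬-cong-⇔ (mk⇔ (cong to) to-injective) ×-⇔ ¬-cong-⇔ (arcs a b))
  where open _≅_ I

-- Four local properties of a point, preserved by isomorphisms; they are the
-- invariants separating F^{xyz} from F^{yxz}.

Source : ∀ {A : Set} → (A → A → Set) → A → Set
Source R a = ∀ b → ¬ R b a

ThinSource : ∀ {A : Set} → (A → A → Set) → A → Set
ThinSource R a = Source R a × (∀ b c → R a b → R a c → b ≡ c)

InClosed : ∀ {A : Set} → (A → A → Set) → A → Set
InClosed R a = ∀ b → R b a → R a b

StrictlyOutClosed : ∀ {A : Set} → (A → A → Set) → A → Set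
StrictlyOutClosed R a = InClosed (flip R) a × ∃ λ b → R b a × ¬ R a b

module _ {A B : Set} {R : A → A → Set} {S : B → B → Set} (I : R ≅ S) where
  open _≅_ I

  source-preserved : ∀ a → Source R a → Source S (to a)
  source-preserved a src b b→a = src (from b) (reflectˡ b→a)

  thinSource-preserved : ∀ a → ThinSource R a → ThinSource S (to a)
  thinSource-preserved a (src , thin) = source-preserved a src , λ b c a→b a→c →
    from-injective (thin (from b) (from c) (reflectʳ a→b) (reflectʳ a→c))

  inClosed-preserved : ∀ a → InClosed R a → InClosed S (to a)
  inClosed-preserved a closed b b→a =
    subst (S (to a)) (to-from b) (preserve (closed (from b) (reflectˡ b→a)))

  outClosed-preserved : ∀ a → InClosed (flip R) a → InClosed (flip S) (to a)
  outClosed-preserved a closed c a→c =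
    subst (λ t → S t (to a)) (to-from c) (preserve (closed (from c) (reflectʳ a→c)))

  strictlyOutClosed-preserved : ∀ a → StrictlyOutClosed R a → StrictlyOutClosed S (to a)
  strictlyOutClosed-preserved a (closed , b , b→a , a↛b) =
    outClosed-preserved a closed , to b , preserve b→a , a↛b ∘ reflect

applyLab-map : ∀ {U U′ : Set} {G : U → U → Set} {H : U′ → U′ → Set} (g : U → U′) →
  (∀ {a b} → g a ≡ g b → a ≡ b) → (∀ a b → G a b ⇔ H (g a) (g b)) →
  ∀ x a b → applyLab x G a b ⇔ applyLab x H (g a) (g b)
applyLab-map g g-injective G⇔H L0 a b = ⇔-refl
applyLab-map g g-injective G⇔H L1 a b = ¬-cong-⇔ (mk⇔ (cong g) g-injective)
applyLab-map g g-injective G⇔H L+ a b = G⇔H a b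
applyLab-map g g-injective G⇔H L- a b =
  ¬-cong-⇔ (mk⇔ (cong g) g-injective) ×-⇔ ¬-cong-⇔ (G⇔H a b)

applyLab-reverse : ∀ {U : Set} {G : U → U → Set} x a b →
  applyLab x (flip G) a b ⇔ applyLab x G b a
applyLab-reverse L0 a b = ⇔-refl
applyLab-reverse L1 a b = ¬-cong-⇔ (mk⇔ sym sym)
applyLab-reverse L+ a b = ⇔-refl
applyLab-reverse L- a b = ¬-cong-⇔ (mk⇔ sym sym) ×-⇔ ⇔-refl

-- The complementary label: G^{dual x} is the complement of G^x.
dual : Lab → Lab
dual L0 = L1
dual L1 = L0
dual L+ = L-
dual L- = L+

dual-involutive : ∀ x → dual (dual x) ≡ x
dual-involutive L0 = refl
dual-involutive L1 = refl
dual-involutive L+ = refl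
dual-involutive L- = refl

dual-injective : ∀ {x y} → x ≢ y → dual x ≢ dual y
dual-injective {x} {y} x≢y dx≡dy =
  x≢y (trans (sym (dual-involutive x)) (trans (cong dual dx≡dy) (dual-involutive y)))

-- For an irreflexive decidable G, the complement of G^x is G^{dual x}; Q is any
-- proposition equivalent to a ≢ b (for instance an inequality of injected points).
applyLab-complement : ∀ {U : Set} (G : U → U → Set) → (∀ a b → Dec (G a b)) →
  (∀ a → ¬ G a a) → ∀ x {Q : Set} {a b} → Q ⇔ (a ≢ b) →
  (Q × ¬ applyLab x G a b) ⇔ applyLab (dual x) G a b
applyLab-complement G G? irreflexive L0 Q⇔≢ =
  mk⇔ (Equivalence.to Q⇔≢ ∘ proj₁) (λ a≢b → Equivalence.from Q⇔≢ a≢b , λ ())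
applyLab-complement G G? irreflexive L1 Q⇔≢ =
  mk⇔ (λ (q , ¬a≢b) → ¬a≢b (Equivalence.to Q⇔≢ q)) λ ()
applyLab-complement G G? irreflexive L+ Q⇔≢ = Q⇔≢ ×-⇔ ⇔-refl
applyLab-complement G G? irreflexive L- {a = a} {b} Q⇔≢ =
  mk⇔ (λ (q , ¬co) → decidable-stable (G? a b) λ ¬g → ¬co (Equivalence.to Q⇔≢ q , ¬g))
      (λ g → Equivalence.from Q⇔≢ (λ { refl → irreflexive a g }) , λ (_ , ¬g) → ¬g g)

line-irreflexive : ∀ {n} {F : Digraph n} → Simple F → ∀ p → ¬ LineArc F p p
line-irreflexive {F = F} simple ((u , v) , uv) v≡u =
  subst T (simple u) (subst (λ t → T (F u t)) v≡u uv)

-- Complementing the (-)-part of W between a vertex and an arc gives the (+)-part;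
-- the distinctness condition q of the complement holds automatically there.
complement-incidence : ∀ {V Q : Set} {v w : V} → Q → Dec (v ≡ w) →
  (Q × ¬ v ≢ w) ⇔ (v ≡ w)
complement-incidence q v≟w =
  mk⇔ (decidable-stable v≟w ∘ proj₂) (λ v≡w → q , λ v≢w → v≢w v≡w)

complement-minus : ∀ {n} (F : Digraph n) → Simple F → ∀ x y a b →
  Complement (XYZ F x y L-) a b ⇔ XYZ F (dual x) (dual y) L+ a b
complement-minus F simple x y (inj₁ a) (inj₁ b) =
  applyLab-complement (λ u v → T (F u v)) (λ u v → T? (F u v)) (λ u → subst T (simple u)) x
    (¬-cong-⇔ (mk⇔ inj₁-injective (cong inj₁)))
complement-minus F simple x y (inj₂ p) (inj₂ q) =
  applyLab-complement (LineArc F) (λ p q → head p ≟ tail q) (line-irreflexive simple) y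
    (¬-cong-⇔ (mk⇔ inj₂-injective (cong inj₂)))
complement-minus F simple x y (inj₁ v) (inj₂ e) = complement-incidence (λ ()) (v ≟ tail e)
complement-minus F simple x y (inj₂ e) (inj₁ v) = complement-incidence (λ ()) (v ≟ head e)

W-out⇔in : ∀ {n m} {F : Digraph n} {G : Digraph m} z {v v′} {e : Arc F} {e′ : Arc G} →
  (InPlusMinus z → (v ≡ tail e) ⇔ (v′ ≡ head e′)) → Wout z v e ⇔ Win z e′ v′
W-out⇔in L0 incidence = ⇔-refl
W-out⇔in L1 incidence = ⇔-refl
W-out⇔in L+ incidence = incidence (inj₁ refl)
W-out⇔in L- incidence = ¬-cong-⇔ (incidence (inj₂ refl))

W-in⇔out : ∀ {n m} {F : Digraph n} {G : Digraph m} z {v v′} {e : Arc F} {e′ : Arc G} →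
  (InPlusMinus z → (v ≡ head e) ⇔ (v′ ≡ tail e′)) → Win z e v ⇔ Wout z v′ e′
W-in⇔out L0 incidence = ⇔-refl
W-in⇔out L1 incidence = ⇔-refl
W-in⇔out L+ incidence = incidence (inj₁ refl)
W-in⇔out L- incidence = ¬-cong-⇔ (incidence (inj₂ refl))

incidence-free-or-not : ∀ z → ¬ InPlusMinus z ⊎ InPlusMinus z
incidence-free-or-not L0 = inj₁ λ { (inj₁ ()) ; (inj₂ ()) }
incidence-free-or-not L1 = inj₁ λ { (inj₁ ()) ; (inj₂ ()) }
incidence-free-or-not L+ = inj₂ (inj₁ refl)
incidence-free-or-not L- = inj₂ (inj₂ refl)

low? : ∀ x → Dec (InZeroPlus x)
low? L0 = yes (inj₁ refl)
low? L1 = no λ { (inj₁ ()) ; (inj₂ ()) }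
low? L+ = yes (inj₂ refl)
low? L- = no λ { (inj₁ ()) ; (inj₂ ()) }

zero-low : InZeroPlus L0
zero-low = inj₁ refl

plus-low : InZeroPlus L+
plus-low = inj₂ refl

one-high : ¬ InZeroPlus L1
one-high (inj₁ ())
one-high (inj₂ ())

minus-high : ¬ InZeroPlus L-
minus-high (inj₁ ())
minus-high (inj₂ ())

-- Reversal: (Inv G)^{xyz} is G^{xyz} with all arcs reversed, so the swap
-- problem, connectivity and regularity are the same for Inv G and G.
module Reversal {n : ℕ} (G : Digraph n) where

  reverse : Arc (Inv G) → Arc G
  reverse ((u , v) , uv) = (v , u) , uv

  unreverse : Arc G → Arc (Inv G)
  unreverse ((u , v) , uv) = (v , u) , uv

  reverse-injective : ∀ {p q} → reverse p ≡ reverse q → p ≡ q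
  reverse-injective eq = cong unreverse eq

  reverse-point : Fin n ⊎ Arc (Inv G) → Fin n ⊎ Arc G
  reverse-point (inj₁ v) = inj₁ v
  reverse-point (inj₂ e) = inj₂ (reverse e)

  unreverse-point : Fin n ⊎ Arc G → Fin n ⊎ Arc (Inv G)
  unreverse-point (inj₁ v) = inj₁ v
  unreverse-point (inj₂ e) = inj₂ (unreverse e)

  reverses-arcs : ∀ x y z a b →
    XYZ (Inv G) x y z a b ⇔ XYZ G x y z (reverse-point b) (reverse-point a)
  reverses-arcs x y z (inj₁ a) (inj₁ b) = applyLab-reverse x a b
  reverses-arcs x y z (inj₂ p) (inj₂ q) =
    ⇔-trans (applyLab-map reverse reverse-injective (λ _ _ → mk⇔ sym sym) y p q)
            (applyLab-reverse y (reverse p) (reverse q))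
  reverses-arcs x y z (inj₁ v) (inj₂ e) = W-out⇔in z λ _ → ⇔-refl
  reverses-arcs x y z (inj₂ e) (inj₁ v) = W-in⇔out z λ _ → ⇔-refl

  inverse-reverses : ∀ x y z → XYZ (Inv G) x y z ≅ flip (XYZ G x y z)
  inverse-reverses x y z = mkIso reverse-point unreverse-point
    (λ { (inj₁ v) → refl ; (inj₂ e) → refl })
    (λ { (inj₁ v) → refl ; (inj₂ e) → refl })
    (reverses-arcs x y z)

  inverse-swap : ∀ x y z →
    (XYZ (Inv G) x y z ≅ XYZ (Inv G) y x z) ⇔ (XYZ G x y z ≅ XYZ G y x z)
  inverse-swap x y z = ⇔-trans (iso-conj (inverse-reverses x y z) (inverse-reverses y x z))
                               (mk⇔ iso-reverse iso-reverse)

  walk-inverse : ∀ {a b} → Walk (Inv G) a b → Walk G a b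
  walk-inverse stop = stop
  walk-inverse (fwd vw rest) = bwd vw (walk-inverse rest)
  walk-inverse (bwd wv rest) = fwd wv (walk-inverse rest)

  connected-inverse : Connected (Inv G) → Connected G
  connected-inverse connected a b = walk-inverse (connected a b)

  regular-inverse : Regular (Inv G) ⇔ Regular G
  regular-inverse = mk⇔ (λ (k , deg) → k , swap ∘ deg) (λ (k , deg) → k , swap ∘ deg)

module FunctionDigraph {n : ℕ} (F : Digraph n) (f : Fin n → Fin n)
  (spec : ∀ u v → (F u v ≡ true) ⇔ (v ≡ f u)) where

  arc⇔ : ∀ {u v} → T (F u v) ⇔ (v ≡ f u)
  arc⇔ {u} {v} = ⇔-trans T-≡ (spec u v)

  arc : Fin n → Arc F
  arc u = (u , f u) , Equivalence.from arc⇔ refl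

  head-arc : (e : Arc F) → head e ≡ f (tail e)
  head-arc ((u , v) , uv) = Equivalence.to arc⇔ uv

  arc-tail : (e : Arc F) → arc (tail e) ≡ e
  arc-tail ((u , v) , uv) with refl ← Equivalence.to arc⇔ uv =
    cong ((u , f u) ,_) (T-irrelevant _ _)

  tail-injective : ∀ {e e′ : Arc F} → tail e ≡ tail e′ → e ≡ e′
  tail-injective {e} {e′} eq = trans (sym (arc-tail e)) (trans (cong arc eq) (arc-tail e′))

  arc-injective : ∀ {a b} → arc a ≡ arc b → a ≡ b
  arc-injective = cong tail

  arc-line : ∀ a b → T (F a b) ⇔ LineArc F (arc a) (arc b)
  arc-line a b = ⇔-trans arc⇔ (mk⇔ sym sym)

  -- Exchanging vertices and arcs: vertices go to arcs by arc, and arcs go back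
  -- to vertices by a bijection τ carrying F^l onto F and W onto its reverse.
  -- Any such τ gives F^{xyz} ≅ F^{yxz}.
  module Exchange (z : Lab) (τ : Arc F → Fin n) (σ : Fin n → Arc F)
    (τσ : ∀ v → τ (σ v) ≡ v) (στ : ∀ e → σ (τ e) ≡ e)
    (line⇔ : ∀ p q → LineArc F p q ⇔ T (F (τ p) (τ q)))
    (out⇔ : ∀ v e → Wout z v e ⇔ Win z (arc v) (τ e))
    (in⇔ : ∀ e v → Win z e v ⇔ Wout z (τ e) (arc v)) where

    exchange : Fin n ⊎ Arc F → Fin n ⊎ Arc F
    exchange (inj₁ v) = inj₂ (arc v)
    exchange (inj₂ e) = inj₁ (τ e)

    unexchange : Fin n ⊎ Arc F → Fin n ⊎ Arc F
    unexchange (inj₁ v) = inj₂ (σ v)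
    unexchange (inj₂ e) = inj₁ (tail e)

    τ-injective : ∀ {p q} → τ p ≡ τ q → p ≡ q
    τ-injective {p} {q} eq = trans (sym (στ p)) (trans (cong σ eq) (στ q))

    exchange-arcs : ∀ x y a b → XYZ F x y z a b ⇔ XYZ F y x z (exchange a) (exchange b)
    exchange-arcs x y (inj₁ a) (inj₁ b) = applyLab-map arc arc-injective arc-line x a b
    exchange-arcs x y (inj₂ p) (inj₂ q) = applyLab-map τ τ-injective line⇔ y p q
    exchange-arcs x y (inj₁ v) (inj₂ e) = out⇔ v e
    exchange-arcs x y (inj₂ e) (inj₁ v) = in⇔ e v

    swap-iso : ∀ x y → XYZ F x y z ≅ XYZ F y x z
    swap-iso x y = mkIso exchange unexchange
      (λ { (inj₁ v) → cong inj₁ (τσ v) ; (inj₂ e) → cong inj₂ (arc-tail e) })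
      (λ { (inj₁ v) → refl ; (inj₂ e) → cong inj₂ (στ e) })
      (exchange-arcs x y)

  -- p → q in F^l iff tail p → tail q in F, since head p = f (tail p).
  line-tails : ∀ p q → LineArc F p q ⇔ T (F (tail p) (tail q))
  line-tails p q = ⇔-trans (mk⇔ (λ eq → trans (sym eq) (head-arc p))
                                (λ eq → trans (head-arc p) (sym eq)))
                           (⇔-sym arc⇔)

  -- For z ∈ {0,1}, W ignores incidence and τ = tail works.
  exchange-incidence-free : ∀ z → ¬ InPlusMinus z → ∀ x y → XYZ F x y z ≅ XYZ F y x z
  exchange-incidence-free z free = Exchange.swap-iso z tail arc (λ _ → refl) arc-tail
    line-tails
    (λ v e → W-out⇔in z (⊥-elim ∘ free))
    (λ e v → W-in⇔out z (⊥-elim ∘ free))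

  -- For a surjective (hence bijective) f, τ = head works: an arc is determined by its head, and
  -- f (tail e) = head e turns incidence with tails into incidence with heads.
  exchange-surjective : (∀ v → ∃ λ u → f u ≡ v) → ∀ x y z → XYZ F x y z ≅ XYZ F y x z
  exchange-surjective onto x y z = Exchange.swap-iso z head (arc ∘ s) f∘s≗id
    (λ e → trans (cong arc (s-head e)) (arc-tail e))
    (λ p q → ⇔-trans (tail-by-head (head p) q) (⇔-sym arc⇔))
    (λ v e → W-out⇔in z λ _ → tail-by-head v e)
    (λ e v → W-in⇔out z λ _ → mk⇔ sym sym)
    x y
    where
    s : Fin n → Fin n
    s v = proj₁ (onto v)
    f∘s≗id : ∀ v → f (s v) ≡ v
    f∘s≗id v = proj₂ (onto v)
    f-injective : ∀ {a b} → f a ≡ f b → a ≡ b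
    f-injective = section⇒injective f s f∘s≗id
    tail-by-head : ∀ v (e : Arc F) → (v ≡ tail e) ⇔ (head e ≡ f v)
    tail-by-head v e = mk⇔ (λ eq → trans (head-arc e) (cong f (sym eq)))
                           (λ eq → sym (f-injective (trans (sym (head-arc e)) eq)))
    s-head : (e : Arc F) → s (head e) ≡ tail e
    s-head e = Equivalence.from (tail-by-head (s (head e)) e) (sym (f∘s≗id (head e)))

  outdeg-one : ∀ v → outdeg F v ≡ 1
  outdeg-one v = count-unique (F v) (f v) (Equivalence.from (spec v (f v)) refl)
                   (λ u Fvu → Equivalence.to (spec v u) Fvu)

  -- So F is regular iff every in-degree is 1, iff f is surjective (on Fin n a
  -- surjective f is also injective).
  regular⇔surjective : Regular F ⇔ (∀ v → ∃ λ u → f u ≡ v)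
  regular⇔surjective = mk⇔ regular⇒surjective surjective⇒regular
    where
    regular⇒surjective : Regular F → ∀ v → ∃ λ u → f u ≡ v
    regular⇒surjective (k , deg) v with any? (λ u → f u ≟ v)
    ... | yes hit = hit
    ... | no miss = contradiction (trans (sym indeg-zero) indeg-one) λ ()
      where
      indeg-zero : indeg F v ≡ 0
      indeg-zero = count-none (λ u → F u v)
        (λ u → ¬-not λ Fuv → miss (u , sym (Equivalence.to (spec u v) Fuv)))
      indeg-one : indeg F v ≡ 1
      indeg-one = trans (proj₁ (deg v)) (trans (sym (proj₂ (deg v))) (outdeg-one v))

    surjective⇒regular : (∀ v → ∃ λ u → f u ≡ v) → Regular F
    surjective⇒regular onto = 1 , λ v → indeg-one v , outdeg-one v
      where
      s : Fin n → Fin n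
      s v = proj₁ (onto v)
      f∘s≗id : ∀ v → f (s v) ≡ v
      f∘s≗id v = proj₂ (onto v)
      indeg-one : ∀ v → indeg F v ≡ 1
      indeg-one v = count-unique (λ u → F u v) (s v)
        (Equivalence.from (spec (s v) v) (sym (f∘s≗id v)))
        (λ u Fuv → section⇒injective f s f∘s≗id
                     (trans (sym (Equivalence.to (spec u v) Fuv)) (sym (f∘s≗id v))))

  preimage? : ∀ v → (∃ λ u → f u ≡ v) ⊎ (∀ u → f u ≢ v)
  preimage? v with any? (λ u → f u ≟ v)
  ... | yes hit = inj₁ hit
  ... | no miss = inj₂ λ u fu≡v → miss (u , fu≡v)

  no-fixed-point : Simple F → ∀ v → f v ≢ v
  no-fixed-point simple v fv≡v = subst T (simple v) (Equivalence.from arc⇔ (sym fv≡v))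

  back-arc : Simple F → ∀ {y} → ¬ InZeroPlus y → ∀ v → (∀ u → f u ≢ v) →
    applyLab y (λ a b → T (F a b)) (f v) v
  back-arc simple {L0} high = ⊥-elim (high zero-low)
  back-arc simple {L+} high = ⊥-elim (high plus-low)
  back-arc simple {L1} high v no-preimage = no-fixed-point simple v
  back-arc simple {L- } high v no-preimage =
    no-fixed-point simple v , λ fv→v → no-preimage (f v) (sym (Equivalence.to arc⇔ fv→v))

  -- In a connected digraph-function, a fixed point v has a preimage other than
  -- itself if some other vertex t exists: a walk from v to t leaves v along a
  -- reversed arc u → v (a forward step from v stays at f v = v).
  fixed-point-preimage : Connected F → ∀ v t → f v ≡ v → t ≢ v →
    ∃ λ u → u ≢ v × f u ≡ v
  fixed-point-preimage connected v t fv≡v t≢v = leave refl (connected v t)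
    where
    leave : ∀ {a} → a ≡ v → Walk F a t → ∃ λ u → u ≢ v × f u ≡ v
    leave a≡v stop = ⊥-elim (t≢v a≡v)
    leave a≡v (fwd ab rest) =
      leave (trans (Equivalence.to arc⇔ ab) (trans (cong f a≡v) fv≡v)) rest
    leave a≡v (bwd {v = u} ua rest) with u ≟ v
    ... | yes u≡v = leave u≡v rest
    ... | no u≢v = u , u≢v , trans (sym (Equivalence.to arc⇔ ua)) a≡v

  module Separation (w : Fin n) (w-source : ∀ u → f u ≢ w) where

    w-not-head : ∀ (e : Arc F) → w ≢ head e
    w-not-head e w≡head = w-source (tail e) (sym (trans w≡head (head-arc e)))

    w-not-fixed : ∀ v → f v ≡ v → w ≢ v
    w-not-fixed v fv≡v w≡v = w-source v (trans fv≡v (sym w≡v))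

    w-source-of : ∀ {x} y → InZeroPlus x → Source (XYZ F x y L+) (inj₁ w)
    w-source-of y (inj₁ refl) (inj₁ u) ()
    w-source-of y (inj₂ refl) (inj₁ u) uw = w-source u (sym (Equivalence.to arc⇔ uw))
    w-source-of y x-low (inj₂ e) = w-not-head e

    -- For y ∉ {0,+} and F simple, F^{yx+} has no source: an arc has its tail as
    -- in-neighbour; a vertex v with a preimage u has the in-neighbour (u , v) via
    -- W, and a vertex without preimage has the y-arc f v → v.
    no-source : Simple F → ∀ {y} x → ¬ InZeroPlus y → ∀ b → ¬ Source (XYZ F y x L+) b
    no-source simple x y-high (inj₂ e) src = src (inj₁ (tail e)) refl
    no-source simple x y-high (inj₁ v) src with preimage? v
    ... | inj₁ (u , fu≡v) = src (inj₂ (arc u)) (sym fu≡v)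
    ... | inj₂ no-preimage = src (inj₁ (f v)) (back-arc simple y-high v no-preimage)

    nonIso-source : ∀ {x y} → InZeroPlus x → ¬ InZeroPlus y → Simple F →
      ¬ (XYZ F x y L+ ≅ XYZ F y x L+)
    nonIso-source {x} {y} x-low y-high simple I =
      no-source simple x y-high _ (source-preserved I (inj₁ w) (w-source-of y x-low))

    -- In F^{0++}, w is a source whose only out-neighbour is the arc leaving w;
    -- in F^{+0+} every vertex v has the two out-neighbours f v and (v , f v).
    nonIso-thinSource : ¬ (XYZ F L0 L+ L+ ≅ XYZ F L+ L0 L+)
    nonIso-thinSource I =
      not-thin _ (thinSource-preserved I (inj₁ w) (w-source-of L+ zero-low , unique))
      where
      unique : ∀ b c → XYZ F L0 L+ L+ (inj₁ w) b → XYZ F L0 L+ L+ (inj₁ w) c → b ≡ c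
      unique (inj₂ e) (inj₂ e′) w≡tail w≡tail′ =
        cong inj₂ (tail-injective (trans (sym w≡tail) w≡tail′))
      not-thin : ∀ b → ¬ ThinSource (XYZ F L+ L0 L+) b
      not-thin (inj₂ e) (src , _) = src (inj₁ (tail e)) refl
      not-thin (inj₁ v) (_ , thin) with thin (inj₁ (f v)) (inj₂ (arc v)) (Equivalence.from arc⇔ refl) refl
      ... | ()

    -- In F^{1-+}, every in-neighbour of w is an out-neighbour; in F^{-1+} with F
    -- simple no point has this property.
    nonIso-inClosed : Simple F → ¬ (XYZ F L1 L- L+ ≅ XYZ F L- L1 L+)
    nonIso-inClosed simple I = not-closed _ (inClosed-preserved I (inj₁ w) w-closed)
      where
      w-closed : InClosed (XYZ F L1 L- L+) (inj₁ w)
      w-closed (inj₁ u) u≢w = ≢-sym u≢w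
      w-closed (inj₂ e) w≡head = ⊥-elim (w-not-head e w≡head)
      not-closed : ∀ b → ¬ InClosed (XYZ F L- L1 L+) b
      not-closed (inj₂ e) closed = no-fixed-point simple (tail e)
        (sym (trans (closed (inj₁ (tail e)) refl) (head-arc e)))
      not-closed (inj₁ v) closed with preimage? v
      ... | inj₁ (u , fu≡v) =
        no-fixed-point simple v (trans (cong f (closed (inj₂ (arc u)) (sym fu≡v))) fu≡v)
      ... | inj₂ no-preimage =
        proj₂ (closed (inj₁ (f v)) (back-arc simple minus-high v no-preimage))
              (Equivalence.from arc⇔ refl)

    -- In F^{0+-}, the out-neighbours of w are in-neighbours, but the arc (w , f w)
    -- is only an in-neighbour; in F^{+0-}, using connectivity, no point is like that.
    nonIso-strictlyOutClosed : Connected F → ¬ (XYZ F L0 L+ L- ≅ XYZ F L+ L0 L-)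
    nonIso-strictlyOutClosed connected I =
      not-strict _ (strictlyOutClosed-preserved I (inj₁ w) w-strict)
      where
      w-strict : StrictlyOutClosed (XYZ F L0 L+ L-) (inj₁ w)
      w-strict = (λ { (inj₁ _) () ; (inj₂ e) _ → w-not-head e })
               , inj₂ (arc w) , w-not-head (arc w) , λ w≢w → w≢w refl
      not-strict : ∀ b → ¬ StrictlyOutClosed (XYZ F L+ L0 L-) b
      not-strict (inj₂ e) (closed , b , b→e , e↛b) with f (tail e) ≟ tail e
      ... | no not-loop =
        closed (inj₁ (tail e)) (λ tail≡head → not-loop (sym (trans tail≡head (head-arc e)))) refl
      ... | yes loop with b
      ...   | inj₁ v = e↛b λ v≡head → b→e (trans v≡head (trans (head-arc e) loop))
      not-strict (inj₁ v) (closed , _) with f v ≟ v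
      ... | no not-fixed = closed (inj₂ (arc (f v))) (λ v≡fv → not-fixed (sym v≡fv))
                             (Equivalence.to arc⇔ (closed (inj₁ (f v)) (Equivalence.from arc⇔ refl)))
      ... | yes fixed
        with u , u≢v , fu≡v ← fixed-point-preimage connected v w fixed (w-not-fixed v fixed) =
        closed (inj₂ (arc u)) (≢-sym u≢v) (sym fu≡v)

    nonIso-plus : ∀ x y → x ≢ y → (¬ (InZeroPlus x × InZeroPlus y) → Simple F) →
      ¬ (XYZ F x y L+ ≅ XYZ F y x L+)
    nonIso-plus L0 L0 x≢y _ = ⊥-elim (x≢y refl)
    nonIso-plus L1 L1 x≢y _ = ⊥-elim (x≢y refl)
    nonIso-plus L+ L+ x≢y _ = ⊥-elim (x≢y refl)
    nonIso-plus L- L- x≢y _ = ⊥-elim (x≢y refl)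
    nonIso-plus L0 L+ _ _ = nonIso-thinSource
    nonIso-plus L+ L0 _ _ = non-iso-sym nonIso-thinSource
    nonIso-plus L1 L- _ simple = nonIso-inClosed (simple (one-high ∘ proj₁))
    nonIso-plus L- L1 _ simple = non-iso-sym (nonIso-inClosed (simple (minus-high ∘ proj₁)))
    nonIso-plus L0 L1 _ simple = nonIso-source zero-low one-high (simple (one-high ∘ proj₂))
    nonIso-plus L0 L- _ simple = nonIso-source zero-low minus-high (simple (minus-high ∘ proj₂))
    nonIso-plus L+ L1 _ simple = nonIso-source plus-low one-high (simple (one-high ∘ proj₂))
    nonIso-plus L+ L- _ simple = nonIso-source plus-low minus-high (simple (minus-high ∘ proj₂))
    nonIso-plus L1 L0 _ simple =
      non-iso-sym (nonIso-source zero-low one-high (simple (one-high ∘ proj₁)))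
    nonIso-plus L- L0 _ simple =
      non-iso-sym (nonIso-source zero-low minus-high (simple (minus-high ∘ proj₁)))
    nonIso-plus L1 L+ _ simple =
      non-iso-sym (nonIso-source plus-low one-high (simple (one-high ∘ proj₁)))
    nonIso-plus L- L+ _ simple =
      non-iso-sym (nonIso-source plus-low minus-high (simple (minus-high ∘ proj₁)))

    -- z = -: for F simple pass to complements, which are F^{(dual x)(dual y)+};
    -- otherwise {x , y} = {0 , +}.
    nonIso-minus : Connected F → ∀ x y → x ≢ y →
      (¬ (InZeroPlus x × InZeroPlus y) → Simple F) → ¬ (XYZ F x y L- ≅ XYZ F y x L-)
    nonIso-minus connected x y x≢y simple with low? x ×-dec low? y
    ... | no not-both-low = via-complement (simple not-both-low)
      where
      via-complement : Simple F → ¬ (XYZ F x y L- ≅ XYZ F y x L-)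
      via-complement simple′ I =
        nonIso-plus (dual x) (dual y) (dual-injective x≢y) (λ _ → simple′)
          (iso-cong (complement-minus F simple′ x y) (complement-minus F simple′ y x)
                    (iso-complement I))
    ... | yes (inj₁ refl , inj₁ refl) = ⊥-elim (x≢y refl)
    ... | yes (inj₂ refl , inj₂ refl) = ⊥-elim (x≢y refl)
    ... | yes (inj₁ refl , inj₂ refl) = nonIso-strictlyOutClosed connected
    ... | yes (inj₂ refl , inj₁ refl) = non-iso-sym (nonIso-strictlyOutClosed connected)

  characterisation : Connected F → ∀ x y z → (¬ (InZeroPlus x × InZeroPlus y) → Simple F) →
    (¬ (XYZ F x y z ≅ XYZ F y x z)) ⇔ (InPlusMinus z × x ≢ y × ¬ Regular F)
  characterisation connected x y z simple = mk⇔ necessary sufficient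
    where
    sees-incidence : ¬ (XYZ F x y z ≅ XYZ F y x z) → InPlusMinus z
    sees-incidence ¬iso with incidence-free-or-not z
    ... | inj₁ free = ⊥-elim (¬iso (exchange-incidence-free z free x y))
    ... | inj₂ z± = z±

    necessary : ¬ (XYZ F x y z ≅ XYZ F y x z) → InPlusMinus z × x ≢ y × ¬ Regular F
    necessary ¬iso = sees-incidence ¬iso
      , (λ { refl → ¬iso iso-refl })
      , λ regular → ¬iso (exchange-surjective (Equivalence.to regular⇔surjective regular) x y z)

    sufficient : InPlusMinus z × x ≢ y × ¬ Regular F → ¬ (XYZ F x y z ≅ XYZ F y x z)
    sufficient (z± , x≢y , non-regular)
      with w , w-source ← missed-point f (non-regular ∘ Equivalence.from regular⇔surjective)
         | z±
    ... | inj₁ refl = Separation.nonIso-plus w w-source x y x≢y simple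
    ... | inj₂ refl = Separation.nonIso-minus w w-source connected x y x≢y simple

isomorphic⇔≅ : ∀ {A B : Set} {R : A → A → Set} {S : B → B → Set} →
  Isomorphic R S ⇔ (R ≅ S)
isomorphic⇔≅ = mk⇔ wrap _≅_.isomorphism

theorem6p9 : (n : ℕ) → .{{_ : NonZero n}} → (F : Digraph n) →
    Connected F →
    (IsDigraphFunction F ⊎ IsInverseOfDigraphFunction F) →
    (x y z : Lab) →
    (¬ (InZeroPlus x × InZeroPlus y) → Simple F) →
    (¬ Isomorphic (XYZ F x y z) (XYZ F y x z))
      ⇔ (InPlusMinus z × x ≢ y × ¬ Regular F)
theorem6p9 n F connected (inj₁ (f , spec)) x y z simple =
  ⇔-trans (¬-cong-⇔ isomorphic⇔≅)
          (FunctionDigraph.characterisation F f spec connected x y z simple)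
theorem6p9 n .(Inv G) connected (inj₂ (G , (f , spec) , refl)) x y z simple =
  ⇔-trans (¬-cong-⇔ (⇔-trans isomorphic⇔≅ (Reversal.inverse-swap G x y z)))
  (⇔-trans (FunctionDigraph.characterisation G f spec
              (Reversal.connected-inverse G connected) x y z simple)
           (⇔-refl ×-⇔ (⇔-refl ×-⇔ ¬-cong-⇔ (⇔-sym (Reversal.regular-inverse G)))))
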